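{- Let $s$ be a positive integer, and let $(b_1,\dots,b_{s+1})$ and $(k_1,\dots,k_s)$ be sequences of non-negative integers such that $1\leq k_i\leq b_1+\cdots+b_{s+1}$ for $1\leq i\leq s$. Then at least one of the following holds: (1) $1\leq k_i\leq b_i$ for some $1\leq i\leq s$; (2) $-b_j\leq k_i-k_j\leq b_i-1$ for some $1\leq i<j\leq s$; (3) there exist a permutation $w$ of $\{1,\dots,s\}$ and a sequence of non-negative integers $(t_1,\dots,t_s)$ such that $k_{w(j)}-k_{w(j-1)}=b_{w(j)}+t_j$ for $1\leq j\leq s$, where $k_0=w(0):=0$, and moreover $\sum_{j=1}^s t_j\leq b_{s+1}$ and $t_j>0$ whenever $w(j-1)<w(j)$ ($1\leq j\leq s$). -}

module Defs where

open import Data.Nat using (ℕ; zero; suc; _+_)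
open import Data.Fin using (Fin; zero; suc; toℕ)
open import Data.Fin.Permutation using (Permutation′; _⟨$⟩ʳ_)

finSum : ∀ {n} → (Fin n → ℕ) → ℕ
finSum {zero} f = 0
finSum {suc n} f = f zero + finSum (λ i → f (suc i))

-- Indexing convention: paper index i ∈ {1..s} is Fin s element (i-1);
-- paper index i ∈ {1..s+1} is Fin (suc s) element (i-1).

-- w extended with w(0) := 0, values in {0..s} (as ℕ, paper numbering).
-- wExt w j = w(j) for j ∈ {0..s} (j given as Fin (suc s)).
wExt : ∀ {s} → Permutation′ s → Fin (suc s) → ℕ
wExt w zero = 0
wExt w (suc j) = suc (toℕ (w ⟨$⟩ʳ j))

kw : ∀ {s} → (Fin s → ℕ) → Permutation′ s → Fin (suc s) → ℕ
kw k w zero = 0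
kw k w (suc j) = k (w ⟨$⟩ʳ j)

module Submission where

-- Suppose neither (1) nor (2) holds.  Sort the indices 1..s by the
-- value k_i, breaking ties so that among equal values the larger index comes first;
-- let w be the sorting permutation and put k_{w(0)} = 0.  For every step j the
-- difference k_{w(j)} - k_{w(j-1)} is then at least b_{w(j)}, and strictly larger
-- when w(j-1) < w(j): at j = 1 this is the failure of (1), and for j > 1 it is the
-- failure of (2) for the pair {w(j-1), w(j)}, read in the direction fixed by the
-- tie-breaking rule.  Defining t_j as the excess of the j-th step over b_{w(j)},
-- the steps telescope to k_{w(s)} = Σ b_{w(j)} + Σ t_j, and since Σ_j b_{w(j)} is
-- b_1 + ... + b_s while k_{w(s)} ≤ b_1 + ... + b_{s+1}, we get Σ t_j ≤ b_{s+1}.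

open import Defs
open import Data.Nat using (ℕ; suc; _≤_; _<_) renaming (_+_ to _+ℕ_)
open import Data.Fin using (Fin; inject₁; fromℕ) renaming (_<_ to _<ᶠ_; suc to fsuc)
open import Data.Fin.Permutation using (Permutation′; _⟨$⟩ʳ_)
open import Data.Integer using (ℤ; +_; -_; _-_) renaming (_≤_ to _≤ℤ_)
open import Data.Product using (Σ; _×_; ∃-syntax)
open import Data.Sum using (_⊎_)
open import Relation.Binary.PropositionalEquality using (_≡_)

open import Level using (0ℓ)
open import Data.Nat using (zero; _∸_; _≤?_; _<?_; s<s⁻¹)
import Data.Nat.Properties as NP
open import Data.Integer using (_+_; _⊖_; +≤+) renaming (_≤?_ to _≤ℤ?_)
import Data.Integer.Properties as IP
open import Data.Integer.Tactic.RingSolver using (solve-∀)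
open import Data.Fin using (punchIn; zero) renaming (_≤_ to _≤ᶠ_; _<?_ to _<ᶠ?_)
import Data.Fin.Properties as FP
open import Data.Fin.Permutation using (_⟨$⟩ˡ_; insert; insert-punchIn; id; inverseˡ)
open import Data.Product using (_,_; proj₁; proj₂)
open import Data.Product.Relation.Binary.Lex.NonStrict using (×-Lex; ×-total; ×-transitive)
open import Data.Sum using (inj₁; inj₂; reduce; swap)
open import Data.Empty using (⊥-elim)
open import Function using (_∘_; flip; const)
open import Relation.Binary using (Rel; Total; Transitive; tri<; tri≈; tri>)
open import Relation.Nullary using (¬_; Dec; yes; no; contradiction)
open import Relation.Nullary.Decidable using (_×-dec_)
open import Relation.Binary.PropositionalEquality
  using (_≢_; refl; sym; trans; cong; cong₂; subst; subst₂; module ≡-Reasoning)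
open import Algebra.Properties.CommutativeMonoid.Sum NP.+-0-commutativeMonoid
  using (sum; sum-permute; ∑-distrib-+; sum-init-last)

finSum≡sum : ∀ {n} (f : Fin n → ℕ) → finSum f ≡ sum f
finSum≡sum {zero}  f = refl
finSum≡sum {suc n} f = cong (f zero +ℕ_) (finSum≡sum (f ∘ fsuc))

finSum-+ : ∀ {n} (f g : Fin n → ℕ) → finSum (λ j → f j +ℕ g j) ≡ finSum f +ℕ finSum g
finSum-+ f g = begin
  finSum (λ j → f j +ℕ g j) ≡⟨ finSum≡sum (λ j → f j +ℕ g j) ⟩
  sum (λ j → f j +ℕ g j)    ≡⟨ ∑-distrib-+ f g ⟩
  sum f +ℕ sum g            ≡⟨ sym (cong₂ _+ℕ_ (finSum≡sum f) (finSum≡sum g)) ⟩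
  finSum f +ℕ finSum g      ∎
  where open ≡-Reasoning

finSum-last : ∀ {n} (f : Fin (suc n) → ℕ) → finSum f ≡ finSum (f ∘ inject₁) +ℕ f (fromℕ n)
finSum-last {n} f = begin
  finSum f                           ≡⟨ finSum≡sum f ⟩
  sum f                              ≡⟨ sum-init-last f ⟩
  sum (f ∘ inject₁) +ℕ f (fromℕ n)   ≡⟨ cong (_+ℕ f (fromℕ n)) (sym (finSum≡sum (f ∘ inject₁))) ⟩
  finSum (f ∘ inject₁) +ℕ f (fromℕ n) ∎
  where open ≡-Reasoning

finSum-permute : ∀ {n} (f : Fin n → ℕ) (w : Permutation′ n) → finSum (f ∘ (w ⟨$⟩ʳ_)) ≡ finSum f
finSum-permute f w = begin
  finSum (f ∘ (w ⟨$⟩ʳ_)) ≡⟨ finSum≡sum (f ∘ (w ⟨$⟩ʳ_)) ⟩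
  sum (f ∘ (w ⟨$⟩ʳ_))    ≡⟨ sym (sum-permute f w) ⟩
  sum f                  ≡⟨ sym (finSum≡sum f) ⟩
  finSum f               ∎
  where open ≡-Reasoning

telescope : ∀ n (F : Fin (suc n) → ℕ) (g : Fin n → ℕ) →
            (∀ j → F (fsuc j) ≡ F (inject₁ j) +ℕ g j) → F (fromℕ n) ≡ F zero +ℕ finSum g
telescope zero    F g step = sym (NP.+-identityʳ (F zero))
telescope (suc n) F g step = begin
  F (fromℕ (suc n))                          ≡⟨ telescope n (F ∘ fsuc) (g ∘ fsuc) (step ∘ fsuc) ⟩
  F (fsuc zero) +ℕ finSum (g ∘ fsuc)         ≡⟨ cong (_+ℕ finSum (g ∘ fsuc)) (step zero) ⟩
  F zero +ℕ g zero +ℕ finSum (g ∘ fsuc)      ≡⟨ NP.+-assoc (F zero) (g zero) _ ⟩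
  F zero +ℕ finSum g                         ∎
  where open ≡-Reasoning

Gap : Set → ℕ → ℕ → ℕ → Set
Gap P a y c = a +ℕ y ≤ c × (P → a +ℕ y < c)

excess-split : ∀ a y c → a +ℕ y ≤ c → c ≡ a +ℕ (y +ℕ (c ∸ (a +ℕ y)))
excess-split a y c a+y≤c = begin
  c                            ≡⟨ NP.m+[n∸m]≡n a+y≤c ⟨
  a +ℕ y +ℕ (c ∸ (a +ℕ y))     ≡⟨ NP.+-assoc a y _ ⟩
  a +ℕ (y +ℕ (c ∸ (a +ℕ y)))   ∎
  where open ≡-Reasoning

+[m+n]-+m≡+n : ∀ m n → + (m +ℕ n) - + m ≡ + n
+[m+n]-+m≡+n m n = begin
  + (m +ℕ n) - + m     ≡⟨ IP.[+m]-[+n]≡m⊖n (m +ℕ n) m ⟩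
  (m +ℕ n) ⊖ m         ≡⟨ IP.≤-⊖ (NP.m≤m+n m n) ⟩
  + (m +ℕ n ∸ m)       ≡⟨ cong +_ (NP.m+n∸m≡n m n) ⟩
  + n                  ∎
  where open ≡-Reasoning

module GapSequence {n} (F : Fin (suc n) → ℕ) (B : Fin n → ℕ) (P : Fin n → Set)
                   (gap : ∀ j → Gap (P j) (F (inject₁ j)) (B j) (F (fsuc j))) where

  excess : Fin n → ℕ
  excess j = F (fsuc j) ∸ (F (inject₁ j) +ℕ B j)

  step-decomposition : ∀ j → F (fsuc j) ≡ F (inject₁ j) +ℕ (B j +ℕ excess j)
  step-decomposition j = excess-split (F (inject₁ j)) (B j) (F (fsuc j)) (proj₁ (gap j))

  step-difference : ∀ j → + F (fsuc j) - + F (inject₁ j) ≡ + (B j +ℕ excess j)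
  step-difference j = begin
    + F (fsuc j) - + F (inject₁ j)                         ≡⟨ cong (λ c → + c - + F (inject₁ j)) (step-decomposition j) ⟩
    + (F (inject₁ j) +ℕ (B j +ℕ excess j)) - + F (inject₁ j) ≡⟨ +[m+n]-+m≡+n (F (inject₁ j)) _ ⟩
    + (B j +ℕ excess j)                                    ∎
    where open ≡-Reasoning

  excess-positive : ∀ j → P j → 0 < excess j
  excess-positive j p = NP.m<n⇒0<n∸m (proj₂ (gap j) p)

  endpoint : F (fromℕ n) ≡ F zero +ℕ (finSum B +ℕ finSum excess)
  endpoint = trans (telescope n F (λ j → B j +ℕ excess j) step-decomposition)
                   (cong (F zero +ℕ_) (finSum-+ B excess))

module SelectionSort {a ℓ} {A : Set a} (_≼_ : Rel A ℓ)
                     (≼-trans : Transitive _≼_) (≼-total : Total _≼_) where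

  ≼-refl : ∀ {x} → x ≼ x
  ≼-refl {x} = reduce (≼-total x x)

  minimum : ∀ {m} (f : Fin (suc m) → A) → Σ (Fin (suc m)) λ M → ∀ i → f M ≼ f i
  minimum {zero}  f = zero , λ { zero → ≼-refl }
  minimum {suc m} f with minimum (f ∘ fsuc)
  ... | M , least with ≼-total (f zero) (f (fsuc M))
  ... | inj₁ first≼M = zero , λ { zero → ≼-refl ; (fsuc i) → ≼-trans first≼M (least i) }
  ... | inj₂ M≼first = fsuc M , λ { zero → M≼first ; (fsuc i) → least i }

  -- Put a minimum first and sort the remaining indices (renumbered by punchIn).
  sortingPermutation : ∀ m (f : Fin (suc m) → A) →
    Σ (Permutation′ (suc m)) λ w → ∀ j → f (w ⟨$⟩ʳ inject₁ j) ≼ f (w ⟨$⟩ʳ fsuc j)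
  sortingPermutation zero    f = id , λ ()
  sortingPermutation (suc m) f with minimum f
  ... | M , least with sortingPermutation m (f ∘ punchIn M)
  ... | w , sorted = insert zero M w , ordered
    where
    tail : ∀ j → insert zero M w ⟨$⟩ʳ fsuc j ≡ punchIn M (w ⟨$⟩ʳ j)
    tail = insert-punchIn zero M w
    ordered : ∀ j → f (insert zero M w ⟨$⟩ʳ inject₁ j) ≼ f (insert zero M w ⟨$⟩ʳ fsuc j)
    ordered zero     = subst (f M ≼_) (cong f (sym (tail zero))) (least _)
    ordered (fsuc j) = subst₂ _≼_ (cong f (sym (tail (inject₁ j)))) (cong f (sym (tail (fsuc j))))
                              (sorted j)

Close : ℕ → ℕ → ℕ → ℕ → Set
Close a c x y = (- (+ y) ≤ℤ + a - + c) × (+ a - + c ≤ℤ + x - + 1)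

difference-mono : ∀ p q r u → p +ℕ u ≤ r +ℕ q → + p - + q ≤ℤ + r - + u
difference-mono p q r u p+u≤r+q = begin
  + p - + q                    ≡⟨ shift (+ p) (+ q) (+ u) ⟩
  + p + + u - (+ q + + u)      ≡⟨ cong (_- (+ q + + u)) (IP.pos-+ p u) ⟨
  + (p +ℕ u) - (+ q + + u)     ≤⟨ IP.+-monoˡ-≤ (- (+ q + + u)) (+≤+ p+u≤r+q) ⟩
  + (r +ℕ q) - (+ q + + u)     ≡⟨ cong (_- (+ q + + u)) (IP.pos-+ r q) ⟩
  + r + + q - (+ q + + u)      ≡⟨ cancel (+ r) (+ q) (+ u) ⟩
  + r - + u                    ∎
  where
  open IP.≤-Reasoning
  shift : ∀ (P Q U : ℤ) → P - Q ≡ P + U - (Q + U)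
  shift = solve-∀
  cancel : ∀ (R Q U : ℤ) → R + Q - (Q + U) ≡ R - U
  cancel = solve-∀

not-close : ∀ a c x y → ¬ Close a c x y → a +ℕ y < c ⊎ c +ℕ x ≤ a
not-close a c x y far with a +ℕ y <? c | c +ℕ x ≤? a
... | yes above | _         = inj₁ above
... | no _      | yes below = inj₂ below
... | no ¬above | no ¬below = contradiction (lower , upper) far
  where
  lower : - (+ y) ≤ℤ + a - + c
  lower = subst (_≤ℤ + a - + c) (IP.+-identityˡ (- (+ y))) (difference-mono 0 y a c (NP.≮⇒≥ ¬above))
  upper : + a - + c ≤ℤ + x - + 1
  upper = difference-mono a c x 1 (subst₂ _≤_ (NP.+-comm 1 a) (NP.+-comm c x) (NP.≰⇒> ¬below))

_⊑_ : ∀ {s} → Rel (ℕ × Fin s) 0ℓ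
_⊑_ = ×-Lex _≡_ _≤_ (flip _≤ᶠ_)

⊑-total : ∀ {s} → Total (_⊑_ {s})
⊑-total = ×-total {_≈₁_ = _≡_} {_≤₁_ = _≤_} {_≤₂_ = flip _≤ᶠ_} sym NP._≟_ NP.≤-antisym NP.≤-total (λ i j → swap (FP.≤-total i j))

⊑-trans : ∀ {s} → Transitive (_⊑_ {s})
⊑-trans = ×-transitive {_≈₁_ = _≡_} {_≤₁_ = _≤_} {_≤₂_ = flip _≤ᶠ_} NP.≤-isPartialOrder (flip FP.≤-trans)

-- In this order a value never decreases, and it strictly increases when the
-- index does (equal values would list the larger index first).
⊑⇒≤ : ∀ {s x y} {i j : Fin s} → (x , i) ⊑ (y , j) → x ≤ y
⊑⇒≤ (inj₁ (x≤y , _)) = x≤y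
⊑⇒≤ (inj₂ (x≡y , _)) = NP.≤-reflexive x≡y

⊑⇒< : ∀ {s x y} {i j : Fin s} → i <ᶠ j → (x , i) ⊑ (y , j) → x < y
⊑⇒< i<j (inj₁ (x≤y , x≢y)) = NP.≤∧≢⇒< x≤y x≢y
⊑⇒< i<j (inj₂ (_ , j≤i))   = ⊥-elim (NP.<⇒≱ i<j j≤i)

adjacent-distinct : ∀ {n} (w : Permutation′ (suc n)) (j : Fin n) → w ⟨$⟩ʳ inject₁ j ≢ w ⟨$⟩ʳ fsuc j
adjacent-distinct w j same = FP.<⇒≢ (FP.≤̄⇒inject₁< FP.≤-refl) (begin
  inject₁ j                   ≡⟨ inverseˡ w ⟨
  w ⟨$⟩ˡ (w ⟨$⟩ʳ inject₁ j)   ≡⟨ cong (w ⟨$⟩ˡ_) same ⟩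
  w ⟨$⟩ˡ (w ⟨$⟩ʳ fsuc j)      ≡⟨ inverseˡ w ⟩
  fsuc j                      ∎)
  where open ≡-Reasoning

module NeitherSmallNorClose (m : ℕ) (b : Fin (suc (suc m)) → ℕ) (k : Fin (suc m) → ℕ)
  (bounded : ∀ i → 1 ≤ k i × k i ≤ finSum b)
  (¬small : ¬ (∃[ i ] (1 ≤ k i × k i ≤ b (inject₁ i))))
  (¬close : ¬ (∃[ i ] ∃[ j ] (i <ᶠ j × Close (k i) (k j) (b (inject₁ i)) (b (inject₁ j))))) where

  width : Fin (suc m) → ℕ
  width i = b (inject₁ i)

  exceeds-width : ∀ i → width i < k i
  exceeds-width i = NP.≰⇒> (λ k≤b → ¬small (i , proj₁ (bounded i) , k≤b))

  adjacent-gap : ∀ {i i'} → i ≢ i' → (k i , i) ⊑ (k i' , i') → Gap (i <ᶠ i') (k i) (width i') (k i')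
  adjacent-gap {i} {i'} i≢i' i⊑i' with FP.<-cmp i i'
  ... | tri≈ _ i≡i' _ = ⊥-elim (i≢i' i≡i')
  ... | tri< i<i' _ _ with not-close (k i) (k i') (width i) (width i') (λ c → ¬close (i , i' , i<i' , c))
  ...   | inj₁ above = NP.<⇒≤ above , const above
  ...   | inj₂ below = ⊥-elim (NP.<⇒≱ (⊑⇒< i<i' i⊑i') (NP.m+n≤o⇒m≤o (k i') below))
  adjacent-gap {i} {i'} i≢i' i⊑i' | tri> _ _ i'<i
    with not-close (k i') (k i) (width i') (width i) (λ c → ¬close (i' , i , i'<i , c))
  ...   | inj₁ above = ⊥-elim (NP.<⇒≱ (NP.≤-<-trans (NP.m≤m+n (k i') (width i)) above) (⊑⇒≤ i⊑i'))
  ...   | inj₂ below = below , λ i<i' → ⊥-elim (FP.<-asym i<i' i'<i)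

  open SelectionSort (_⊑_ {suc m}) ⊑-trans ⊑-total

  sorting : Σ (Permutation′ (suc m)) λ w → ∀ j → (k (w ⟨$⟩ʳ inject₁ j) , w ⟨$⟩ʳ inject₁ j) ⊑ (k (w ⟨$⟩ʳ fsuc j) , w ⟨$⟩ʳ fsuc j)
  sorting = sortingPermutation m (λ i → k i , i)

  w : Permutation′ (suc m)
  w = proj₁ sorting

  Ascent : Fin (suc m) → Set
  Ascent j = wExt w (inject₁ j) < wExt w (fsuc j)

  -- Along the sorted chain 0 = k_{w(0)}, k_{w(1)}, …, k_{w(s)} each step rises by at
  -- least b_{w(j)}, strictly at ascents: the first step by (1), the others by (2).
  step-gap : ∀ j → Gap (Ascent j) (kw k w (inject₁ j)) (width (w ⟨$⟩ʳ j)) (kw k w (fsuc j))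
  step-gap zero     = NP.<⇒≤ (exceeds-width _) , const (exceeds-width _)
  step-gap (fsuc j) = proj₁ gap , proj₂ gap ∘ s<s⁻¹
    where gap = adjacent-gap (adjacent-distinct w j) (proj₂ sorting j)

  open GapSequence (kw k w) (width ∘ (w ⟨$⟩ʳ_)) Ascent step-gap

  -- The chain ends at some k_i ≤ Σ b, and its prescribed gaps add up to b_1 + … + b_s.
  excess-bound : finSum excess ≤ b (fromℕ (suc m))
  excess-bound = NP.+-cancelˡ-≤ (finSum width) _ _ (begin
    finSum width +ℕ finSum excess               ≡⟨ cong (_+ℕ finSum excess) (finSum-permute width w) ⟨
    finSum (width ∘ (w ⟨$⟩ʳ_)) +ℕ finSum excess ≡⟨ endpoint ⟨
    kw k w (fromℕ (suc m))                      ≤⟨ proj₂ (bounded _) ⟩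
    finSum b                                    ≡⟨ finSum-last b ⟩
    finSum width +ℕ b (fromℕ (suc m))           ∎)
    where open NP.≤-Reasoning

  outcome : Σ (Permutation′ (suc m)) λ w → Σ (Fin (suc m) → ℕ) λ t →
      (∀ j → (+ kw k w (fsuc j)) - (+ kw k w (inject₁ j)) ≡ + (b (inject₁ (w ⟨$⟩ʳ j)) +ℕ t j))
      × finSum t ≤ b (fromℕ (suc m))
      × (∀ j → wExt w (inject₁ j) < wExt w (fsuc j) → 0 < t j)
  outcome = w , excess , step-difference , excess-bound , excess-positive

small? : ∀ {s} (b : Fin (suc s) → ℕ) (k : Fin s → ℕ) i → Dec (1 ≤ k i × k i ≤ b (inject₁ i))
small? b k i = (1 ≤? k i) ×-dec (k i ≤? b (inject₁ i))

close? : ∀ {s} (b : Fin (suc s) → ℕ) (k : Fin s → ℕ) i j →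
         Dec (i <ᶠ j × Close (k i) (k j) (b (inject₁ i)) (b (inject₁ j)))
close? b k i j = (i <ᶠ? j) ×-dec ((- (+ b (inject₁ j)) ≤ℤ? + k i - + k j) ×-dec (+ k i - + k j ≤ℤ? + b (inject₁ i) - + 1))

lemma5p4 : (s : ℕ) → 1 ≤ s → (b : Fin (suc s) → ℕ) → (k : Fin s → ℕ)
    → (∀ i → 1 ≤ k i × k i ≤ finSum b)
    → (∃[ i ] (1 ≤ k i × k i ≤ b (inject₁ i)))
      ⊎ (∃[ i ] ∃[ j ] (i <ᶠ j × (- (+ b (inject₁ j)) ≤ℤ (+ k i) - (+ k j)) × ((+ k i) - (+ k j) ≤ℤ (+ b (inject₁ i)) - (+ 1))))
      ⊎ (Σ (Permutation′ s) λ w → Σ (Fin s → ℕ) λ t →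
          (∀ j → (+ kw k w (fsuc j)) - (+ kw k w (inject₁ j)) ≡ + (b (inject₁ (w ⟨$⟩ʳ j)) +ℕ t j))
          × finSum t ≤ b (fromℕ s)
          × (∀ j → wExt w (inject₁ j) < wExt w (fsuc j) → 0 < t j))
lemma5p4 zero    ()
lemma5p4 (suc m) _ b k bounded with FP.any? (small? b k) | FP.any? (λ i → FP.any? (close? b k i))
... | yes small | _         = inj₁ small
... | no _      | yes close = inj₂ (inj₁ close)
... | no ¬small | no ¬close = inj₂ (inj₂ (NeitherSmallNorClose.outcome m b k bounded ¬small ¬close))
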